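{- Let \(X:\mathcal U\) and let \(\mathcal V\) be any universe. There is an equivalence between the type of \(\mathcal V\)-covered subsets of \(X\) with values in \(\Omega_{\mathcal U\sqcup\mathcal V}\), i.e. \(\Sigma_{S:X\to\Omega_{\mathcal U\sqcup\mathcal V}}\Sigma_{I:\mathcal V}(I\twoheadrightarrow\mathbb T(S))\), and the type \(\Sigma_{I:\mathcal V}(I\to X)\) of families in \(X\) indexed by types in \(\mathcal V\).
   Context: Work in univalent foundations (intensional Martin-Löf type theory with universes, function and propositional extensionality, propositional truncations). \(\Omega_{\mathcal T}\) is the type of propositions in \(\mathcal T\); a subset of \(X\) is a map \(S:X\to\Omega_{\mathcal T}\). The total space of \(S\) is \(\mathbb T(S):=\Sigma_{x:X}(x\in S)\). A map \(e:I\to Y\) is a surjection (written \(I\twoheadrightarrow Y\)) if for every \(y:Y\) there exists (in the truncated sense) \(i\) with \(e(i)=y\); the type \(I\twoheadrightarrow Y\) consists of maps together with a proof of surjectivity. A subset \(S\) is \(\mathcal V\)-covered if it comes with a type \(I:\mathcal V\) and a surjection \(I\twoheadrightarrow\mathbb T(S)\). -}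

module Defs where

open import Level using (Level; _⊔_; suc; Setω)
open import Data.Product using (Σ; _,_; proj₁; proj₂)
open import Relation.Binary.PropositionalEquality using (_≡_)

is-prop : ∀ {ℓ} → Set ℓ → Set ℓ
is-prop A = (x y : A) → x ≡ y

Ω : (ℓ : Level) → Set (suc ℓ)
Ω ℓ = Σ (Set ℓ) is-prop

FunExt : Setω
FunExt = ∀ {a b} {A : Set a} {B : A → Set b} {f g : (x : A) → B x}
         → ((x : A) → f x ≡ g x) → f ≡ g

PropExt : Setω
PropExt = ∀ {ℓ} {P Q : Set ℓ} → is-prop P → is-prop Q → (P → Q) → (Q → P) → P ≡ Q

record PropTrunc : Setω where
  field
    ∥_∥      : ∀ {ℓ} → Set ℓ → Set ℓ
    ∥∥-prop  : ∀ {ℓ} {A : Set ℓ} → is-prop ∥ A ∥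
    ∣_∣      : ∀ {ℓ} {A : Set ℓ} → A → ∥ A ∥
    ∥∥-rec   : ∀ {ℓ ℓ'} {A : Set ℓ} {P : Set ℓ'} → is-prop P → (A → P) → ∥ A ∥ → P

_∈_ : ∀ {u ℓ} {X : Set u} → X → (X → Ω ℓ) → Set ℓ
x ∈ S = proj₁ (S x)

𝕋 : ∀ {u ℓ} {X : Set u} → (X → Ω ℓ) → Set (u ⊔ ℓ)
𝕋 {X = X} S = Σ X (λ x → x ∈ S)

Surj : PropTrunc → ∀ {i j} → Set i → Set j → Set (i ⊔ j)
Surj pt I Y = Σ (I → Y) (λ e → (y : Y) → ∥ Σ I (λ i → e i ≡ y) ∥)
  where open PropTrunc pt

CoveredSubsets : PropTrunc → ∀ {u} (v : Level) → Set u → Set (suc (u ⊔ v))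
CoveredSubsets pt {u} v X =
  Σ (X → Ω (u ⊔ v)) (λ S → Σ (Set v) (λ I → Surj pt I (𝕋 S)))

Families : ∀ {u} (v : Level) → Set u → Set (u ⊔ suc v)
Families v X = Σ (Set v) (λ I → I → X)

{-# OPTIONS --safe #-}

-- A family f : I → X determines the covered subset "image of f", covered by
-- i ↦ (f i , ∣ i , refl ∣); its values ∥ Σ I (λ i → f i ≡ x) ∥ live in
-- exactly the universe 𝒰 ⊔ 𝒱, which is why subsets are taken in Ω (𝒰 ⊔ 𝒱).
-- Conversely a covered subset (S , e) determines the family
-- proj₁ ∘ e. Family → subset → family is the identity on the nose. For the
-- other round trip, surjectivity of e makes S and the image of proj₁ ∘ e
-- logically equivalent, hence equal by propositional extensionality; all
-- remaining data lies in propositions, so function extensionality closes it.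
module Submission where

open import Defs
open import Level using (Level; _⊔_)
open import Function.Base using (_∘_)
open import Function.Bundles using (_↔_; mk↔ₛ′)
open import Data.Product using (Σ; _,_; proj₁; proj₂)
open import Relation.Binary.PropositionalEquality using (_≡_; refl; cong; subst)
open import Axiom.UniquenessOfIdentityProofs using (UIP; module Constant⇒UIP)

is-prop⇒UIP : ∀ {a} {A : Set a} → is-prop A → UIP A
is-prop⇒UIP A-prop = Constant⇒UIP.≡-irrelevant (λ {x} {y} _ → A-prop x y) (λ _ _ → refl)

Σ-≡-prop : ∀ {a b} {A : Set a} {B : A → Set b} → (∀ x → is-prop (B x))
         → {p q : Σ A B} → proj₁ p ≡ proj₁ q → p ≡ q
Σ-≡-prop B-prop {x , b} {.x , b′} refl = cong (x ,_) (B-prop x b b′)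

module Covering (fe : FunExt) (pe : PropExt) (pt : PropTrunc) where
  open PropTrunc pt

  Π-prop : ∀ {a b} {A : Set a} {B : A → Set b} → (∀ x → is-prop (B x))
         → is-prop ((x : A) → B x)
  Π-prop B-prop f g = fe λ x → B-prop x (f x) (g x)

  is-prop-is-prop : ∀ {a} {A : Set a} → is-prop (is-prop A)
  is-prop-is-prop p = Π-prop (λ _ → Π-prop (λ _ → is-prop⇒UIP p)) p

  Ω-ext : ∀ {ℓ} {P Q : Ω ℓ} → (proj₁ P → proj₁ Q) → (proj₁ Q → proj₁ P) → P ≡ Q
  Ω-ext {P = P , P-prop} {Q , Q-prop} P→Q Q→P =
    Σ-≡-prop (λ _ → is-prop-is-prop) (pe P-prop Q-prop P→Q Q→P)

  Surj-≡ : ∀ {a b} {I : Set a} {Y : Set b} (e₁ e₂ : Surj pt I Y)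
         → proj₁ e₁ ≡ proj₁ e₂ → e₁ ≡ e₂
  Surj-≡ _ _ = Σ-≡-prop (λ _ → Π-prop (λ _ → ∥∥-prop))

  module _ {u w} {X : Set u} {I : Set w} where
    image : (I → X) → X → Ω (w ⊔ u)
    image f x = ∥ Σ I (λ i → f i ≡ x) ∥ , ∥∥-prop

    image-cover : (f : I → X) → Surj pt I (𝕋 (image f))
    image-cover f = (λ i → f i , ∣ i , refl ∣) , λ (x , x∈im) →
      ∥∥-rec ∥∥-prop (λ { (i , refl) → ∣ i , Σ-≡-prop (λ _ → ∥∥-prop) refl ∣ }) x∈im

    image-of-cover : (S : X → Ω (w ⊔ u)) ((e , e-surj) : Surj pt I (𝕋 S))
                   → image (proj₁ ∘ e) ≡ S
    image-of-cover S (e , e-surj) = fe λ x → Ω-ext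
      (∥∥-rec (proj₂ (S x)) λ (i , eᵢ≡x) → subst (_∈ S) eᵢ≡x (proj₂ (e i)))
      (λ x∈S → ∥∥-rec ∥∥-prop (λ (i , eᵢ≡x) → ∣ i , cong proj₁ eᵢ≡x ∣) (e-surj (x , x∈S)))

  module _ {u} (v : Level) (X : Set u) where
    family : CoveredSubsets pt v X → Families v X
    family (_ , I , e , _) = I , proj₁ ∘ e

    covered-image : Families v X → CoveredSubsets pt v X
    covered-image (I , f) = image f , I , image-cover f

    CoveredSubsets-≡ : ∀ {S₁ S₂ I} (e₁ : Surj pt I (𝕋 S₁)) (e₂ : Surj pt I (𝕋 S₂))
                     → S₁ ≡ S₂ → (∀ i → proj₁ (proj₁ e₁ i) ≡ proj₁ (proj₁ e₂ i))
                     → _≡_ {A = CoveredSubsets pt v X} (S₁ , I , e₁) (S₂ , I , e₂)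
    CoveredSubsets-≡ {S} {I = I} e₁ e₂ refl same-points =
      cong (λ e → S , I , e)
        (Surj-≡ e₁ e₂ (fe λ i → Σ-≡-prop (λ x → proj₂ (S x)) (same-points i)))

    covered-image∘family : ∀ c → covered-image (family c) ≡ c
    covered-image∘family (S , I , e) =
      CoveredSubsets-≡ (image-cover _) e (image-of-cover S e) (λ _ → refl)

theorem6p7 : FunExt → PropExt → (pt : PropTrunc)
    → ∀ {u} (v : Level) (X : Set u)
    → CoveredSubsets pt v X ↔ Families v X
theorem6p7 fe pe pt v X =
  mk↔ₛ′ (family v X) (covered-image v X) (λ _ → refl) (covered-image∘family v X)
  where open Covering fe pe pt
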